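{- Let $k\ge1$ and $R\ge1$ be integers. Let $1<m_1\le m_2\le\cdots\le m_R$ be integers, let $\{1,\ldots,R\}=J_1\cup\cdots\cup J_k$ be a decomposition into pairwise disjoint (possibly empty) sets, and let $a_1,\ldots,a_k,b_1,\ldots,b_k\ge1$ be integers. Suppose that \[ \sum_{i=1}^{k}\frac{b_i}{a_i}\prod_{\substack{1\le j\le R\\ j\in J_i}}\left(1-\frac{1}{m_j}\right)^{ -1}\ge1 \quad\text{and}\quad \sum_{i=1}^{k}\frac{b_i}{a_i}\prod_{\substack{1\le j\le R-1\\ j\in J_i}}\left(1-\frac{1}{m_j}\right)^{ -1}<1. \] Then \[ a\prod_{j=1}^{R}(m_j-1)\le F_R(a), \] where $a=a_1\cdots a_k$.
   Context: For an integer $r\ge1$ and real $x\ge1$, $F_r(x)=x^{2^r}-x^{2^{r-1}}$; also $F_0(x)=x-1$. Empty products equal $1$. -}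

module Defs where

open import Data.Nat as ℕ using (ℕ; zero; suc; _∸_; _^_; _<ᵇ_)
open import Data.Integer using (+_)
open import Data.Rational using (ℚ; 0ℚ; 1ℚ; _/_) renaming (_+_ to _+ℚ_; _*_ to _*ℚ_)
open import Data.Fin using (Fin; toℕ)
open import Data.Fin.Subset using (Subset)
open import Data.Fin.Subset.Properties using (_∈?_)
open import Data.List using (List; foldr; map; allFin)
open import Data.Bool using (if_then_else_; _∧_)
open import Relation.Nullary.Decidable using (⌊_⌋)

F : ℕ → ℕ → ℕ
F zero x = x ∸ 1
F (suc r) x = x ^ (2 ^ suc r) ∸ x ^ (2 ^ r)

-- b / a as a rational (a = 0 never occurs under the hypotheses a ≥ 1; junk value 0)
frac : ℕ → ℕ → ℚ
frac b zero = 0ℚ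
frac b (suc n) = (+ b) / suc n

-- (1 - 1/m)⁻¹ = m / (m - 1)  (only used for m > 1; junk value 1 otherwise)
invFactor : ℕ → ℚ
invFactor (suc (suc n)) = (+ suc (suc n)) / suc n
invFactor _ = 1ℚ

-- ∏_{1 ≤ j ≤ L, j ∈ J} (1 - 1/m_j)⁻¹, with j ∈ Fin R representing index toℕ j + 1
prodJ : ∀ {R} → Subset R → (Fin R → ℕ) → ℕ → ℚ
prodJ {R} J m L =
  foldr _*ℚ_ 1ℚ
    (map (λ j → if ⌊ j ∈? J ⌋ ∧ (toℕ j <ᵇ L) then invFactor (m j) else 1ℚ) (allFin R))

sumJ : ∀ {k R} → (Fin k → ℕ) → (Fin k → ℕ) → (Fin k → Subset R) → (Fin R → ℕ) → ℕ → ℚ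
sumJ {k} a b J m L =
  foldr _+ℚ_ 0ℚ (map (λ i → frac (b i) (a i) *ℚ prodJ (J i) m L) (allFin k))

prodℕ : ∀ {n} → (Fin n → ℕ) → ℕ
prodℕ {n} f = foldr ℕ._*_ 1 (map f (allFin n))

module Submission where

-- Lemma 6.  Write λ_j = m_j − 1 (a sorted list of positive integers) and A = a₁ ⋯ a_k.
--
-- Multiplying the sums of the statement by A ∏ λ_j turns both
-- hypotheses into inequalities between natural numbers; comparing the sums at the levels R,
-- r and R − 1 then yields the chain condition: with x_r = A λ₁ ⋯ λ_r,
--   x_r / (x_r − 1) ≤ ∏_{j>r} (1 + 1/λ_j)   for every r < R.  Every such chain satisfies x_R ≤ F_R(A).  More generally v λ₁ ⋯ λ_R ≤ F_R(T)
-- whenever v ≤ T: if some prefix product v λ₁ ⋯ λ_i stays below T^(2^i) we pass to the tail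
-- with the data (v λ₁ ⋯ λ_i, T^(2^i)); otherwise a multiplicative majorization inequality,
-- ∏ (1 + 1/c_i) ≤ ∏ (1 + 1/q_i) for sorted c's whose partial products dominate those of the
-- fractions q_i, compares the λ's with the fractions T, T², T⁴, … and the product telescopes.

open import Defs
open import Data.Nat using (ℕ; zero; suc; _+_; _*_; _∸_; _^_; _≤_; _<_; z≤n; s≤s; _≤?_; _<?_; _<ᵇ_; >-nonZero)
open import Data.Nat.Properties
open import Data.Nat.ListAction using (product)
open import Data.Nat.ListAction.Properties using (product-↭; product≢0)
open import Data.Nat.Tactic.RingSolver using (solve-∀)
open import Data.Integer as ℤ using (+_)
import Data.Integer.Properties as ℤP
open import Data.Rational as Q using (ℚ; 1ℚ; _/_; toℚᵘ) renaming (_≤_ to _≤ℚ_; _<_ to _<ℚ_)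
import Data.Rational.Properties as QP
open import Data.Rational.Solver using (module +-*-Solver)
open import Data.Rational.Unnormalised as U using (ℚᵘ; mkℚᵘ; *≡*; *≤*; *<*)
import Data.Rational.Unnormalised.Properties as UP
open import Data.Bool using (Bool; true; false; if_then_else_; _∧_; T)
open import Data.Bool.Properties using (∧-zeroʳ)
open import Data.Fin using (Fin; toℕ) renaming (zero to fzero; suc to fsuc; _≤_ to _≤ᶠ_)
open import Data.Fin.Properties using (toℕ<n)
open import Data.Fin.Subset using (Subset; _∈_)
open import Data.Fin.Subset.Properties using (_∈?_)
open import Data.List using (List; []; _∷_; _++_; map; length; foldr; tabulate)
open import Data.List.Properties using (tabulate-cong; map-tabulate; length-tabulate)
open import Data.List.Relation.Unary.All as All using (All; []; _∷_)
import Data.List.Relation.Unary.All.Properties as AllP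
open import Data.List.Relation.Unary.AllPairs using (AllPairs; []; _∷_)
open import Data.List.Relation.Unary.AllPairs.Properties using (tabulate⁺-<)
open import Data.List.Relation.Binary.Pointwise using (Pointwise; []; _∷_)
open import Data.List.Relation.Binary.Permutation.Propositional.Properties using (map⁺; shift)
open import Data.Product using (_×_; _,_; proj₁; ∃)
open import Data.Unit using (⊤; tt)
open import Data.Empty using (⊥; ⊥-elim)
open import Function using (_∘_; id)
open import Relation.Nullary using (¬_; Dec; yes; no)
open import Relation.Nullary.Decidable using (_×-dec_; ⌊_⌋)
open import Relation.Binary.PropositionalEquality
open import Algebra.Bundles using (CommutativeSemiring; CommutativeRing)
import Algebra.Properties.CommutativeSemigroup as CommSemigroupProperties
open CommSemigroupProperties *-commutativeSemigroup using (interchange; x∙yz≈y∙xz; x∙yz≈yx∙z; xy∙z≈xz∙y)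

-- A positive fraction n/d is represented by the pair (n , d).
Frac : Set
Frac = ℕ × ℕ

num : Frac → ℕ
num = proj₁

-- 1 + 1/q = (n + d)/n for q = n/d; num⁺ q is the numerator of 1 + 1/q.
num⁺ : Frac → ℕ
num⁺ (n , d) = n + d

product-pick : ∀ {A : Set} (f : A → ℕ) pre x post →
  product (map f (pre ++ x ∷ post)) ≡ f x * product (map f (pre ++ post))
product-pick f pre x post = product-↭ (map⁺ f (shift x pre post))

Below : ℕ → Frac → Set
Below a (n , d) = n < a * d

Covers : ℕ → Frac → Set
Covers c (n , d) = n ≤ c * d

-- Dominated P Q cs qs: the lists have the same length and every prefix satisfies
--   P · ∏ n_i ≤ Q · ∏ c_i d_i,  i.e.  (P/Q) · ∏ q_i ≤ ∏ c_i.
Dominated : ℕ → ℕ → List ℕ → List Frac → Set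
Dominated P Q []       []             = ⊤
Dominated P Q (c ∷ cs) ((n , d) ∷ qs) =
  P * n ≤ Q * (c * d) × Dominated (P * n) (Q * (c * d)) cs qs
Dominated P Q _        _              = ⊥

dominated-antitone : ∀ {P′ P Q} cs qs → P′ ≤ P → Dominated P Q cs qs → Dominated P′ Q cs qs
dominated-antitone []       []             _    _         = tt
dominated-antitone (c ∷ cs) ((n , d) ∷ qs) P′≤P (hd , tl) =
  ≤-trans (*-monoˡ-≤ n P′≤P) hd , dominated-antitone cs qs (*-monoˡ-≤ n P′≤P) tl

dominated-covers : ∀ {a P Q} cs qs → Dominated P Q cs qs → All (a ≤_) cs → All (Below a) qs →
  Pointwise Covers cs qs
dominated-covers []       []             _         []          []          = []
dominated-covers (c ∷ cs) ((n , d) ∷ qs) (_ , dom) (a≤c ∷ a≤cs) (q<a ∷ qs<a) =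
  ≤-trans (<⇒≤ q<a) (*-monoˡ-≤ d a≤c) ∷ dominated-covers cs qs dom a≤cs qs<a

factor-bound : ∀ c n d → n ≤ c * d → suc c * n ≤ c * (n + d)
factor-bound c n d n≤cd = subst (suc c * n ≤_) (sym (distrib c n d)) (+-monoˡ-≤ (c * n) n≤cd)
  where
  distrib : ∀ c n d → c * (n + d) ≡ c * d + c * n
  distrib = solve-∀

termwise-bound : ∀ {cs qs} → Pointwise Covers cs qs →
  product (map suc cs) * product (map num qs) ≤ product cs * product (map num⁺ qs)
termwise-bound []                               = ≤-refl
termwise-bound {c ∷ cs} {(n , d) ∷ qs} (q≤c ∷ rest) =
  subst₂ _≤_ (interchange (suc c) n (product (map suc cs)) (product (map num qs)))
             (interchange c (n + d) (product cs) (product (map num⁺ qs)))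
    (*-mono-≤ (factor-bound c n d q≤c) (termwise-bound rest))

data FirstAtLeast (a : ℕ) : List Frac → Set where
  none : ∀ {qs} → All (Below a) qs → FirstAtLeast a qs
  some : ∀ pre n d post → All (Below a) pre → a * d ≤ n → FirstAtLeast a (pre ++ (n , d) ∷ post)

firstAtLeast : ∀ a qs → FirstAtLeast a qs
firstAtLeast a []             = none []
firstAtLeast a ((n , d) ∷ qs) with n <? a * d
... | no  n≮ad = some [] n d qs [] (≮⇒≥ n≮ad)
... | yes n<ad with firstAtLeast a qs
...   | none below                = none (n<ad ∷ below)
...   | some pre n′ d′ post below ad≤n = some ((n , d) ∷ pre) n′ d′ post (n<ad ∷ below) ad≤n

dominated-merge : ∀ {a n₁ d₁ n d post} pre cs {P Q} → P ≤ Q → All (a ≤_) cs → All (Below a) pre →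
  Dominated (P * n₁) (Q * (a * d₁)) cs (pre ++ (n , d) ∷ post) →
  Dominated P Q cs (pre ++ (n₁ * n , d₁ * d * a) ∷ post)
dominated-merge {a} {n₁} {d₁} {n} {d} {post} [] (c ∷ cs) {P} {Q} _ _ [] (hd , tl) =
  subst₂ _≤_ (*-assoc P n₁ n) (move Q a d₁ c d) hd ,
  subst₂ (λ x y → Dominated x y cs post) (*-assoc P n₁ n) (move Q a d₁ c d) tl
  where
  move : ∀ Q a d₁ c d → Q * (a * d₁) * (c * d) ≡ Q * (c * (d₁ * d * a))
  move = solve-∀
dominated-merge {a} {n₁} {d₁} {n} {d} {post} ((n′ , d′) ∷ pre) (c ∷ cs) {P} {Q} P≤Q (a≤c ∷ a≤cs) (q′<a ∷ pre<a) (_ , tl) =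
  first , dominated-merge pre cs first a≤cs pre<a
            (subst₂ (λ x y → Dominated x y cs (pre ++ (n , d) ∷ post)) (xy∙z≈xz∙y P n₁ n′) (xy∙z≈xz∙y Q (a * d₁) (c * d′)) tl)
  where
  first : P * n′ ≤ Q * (c * d′)
  first = *-mono-≤ P≤Q (≤-trans (<⇒≤ q′<a) (*-monoˡ-≤ d′ a≤c))

merge-inequality : ∀ a n₁ d₁ n d → n₁ ≤ a * d₁ → a * d ≤ n →
  suc a * (n₁ * n + d₁ * d * a) ≤ a * ((n₁ + d₁) * (n + d))
merge-inequality a n₁ d₁ n d q₁≤a a≤q =
  subst (λ x → suc a * (n₁ * x + d₁ * d * a) ≤ a * ((n₁ + d₁) * (x + d)))
        (m+[n∸m]≡n a≤q) (bound (n ∸ a * d))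
  where
  -- write n = a d + v; after expanding, the claim reduces to n₁ v ≤ a d₁ v, i.e. to q₁ ≤ a
  bound : ∀ v → suc a * (n₁ * (a * d + v) + d₁ * d * a) ≤ a * ((n₁ + d₁) * (a * d + v + d))
  bound v = +-cancelʳ-≤ (n₁ * v) _ _ (begin
    suc a * (n₁ * (a * d + v) + d₁ * d * a) + n₁ * v
      ≤⟨ +-monoʳ-≤ (suc a * (n₁ * (a * d + v) + d₁ * d * a)) (*-monoˡ-≤ v q₁≤a) ⟩
    suc a * (n₁ * (a * d + v) + d₁ * d * a) + a * d₁ * v
      ≡⟨ identity a n₁ d₁ d v ⟩
    a * ((n₁ + d₁) * (a * d + v + d)) + n₁ * v ∎)
    where
    open ≤-Reasoning
    identity : ∀ a n₁ d₁ d v → suc a * (n₁ * (a * d + v) + d₁ * d * a) + a * d₁ * v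
                             ≡ a * ((n₁ + d₁) * (a * d + v + d)) + n₁ * v
    identity = solve-∀

merge-step : ∀ a n₁ d₁ n d pre post S A → n₁ ≤ a * d₁ → a * d ≤ n →
  S * product (map num (pre ++ (n₁ * n , d₁ * d * a) ∷ post)) ≤ A * product (map num⁺ (pre ++ (n₁ * n , d₁ * d * a) ∷ post)) →
  suc a * S * (n₁ * product (map num (pre ++ (n , d) ∷ post))) ≤ a * A * ((n₁ + d₁) * product (map num⁺ (pre ++ (n , d) ∷ post)))
merge-step a n₁ d₁ n d pre post S A q₁≤a a≤q merged-bound = begin
  suc a * S * (n₁ * product (map num (pre ++ (n , d) ∷ post)))
    ≡⟨ cong (λ z → suc a * S * (n₁ * z)) (product-pick num pre (n , d) post) ⟩
  suc a * S * (n₁ * (n * N))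
    ≡⟨ lhs-regroup (suc a) S n₁ n N ⟩
  suc a * (S * (n₁ * n * N))
    ≡⟨ cong (λ z → suc a * (S * z)) (sym (product-pick num pre merged post)) ⟩
  suc a * (S * product (map num (pre ++ merged ∷ post)))
    ≤⟨ *-monoʳ-≤ (suc a) merged-bound ⟩
  suc a * (A * product (map num⁺ (pre ++ merged ∷ post)))
    ≡⟨ cong (λ z → suc a * (A * z)) (product-pick num⁺ pre merged post) ⟩
  suc a * (A * ((n₁ * n + d₁ * d * a) * M))
    ≡⟨ mid-regroup (suc a) A (n₁ * n + d₁ * d * a) M ⟩
  suc a * (n₁ * n + d₁ * d * a) * (A * M)
    ≤⟨ *-monoˡ-≤ (A * M) (merge-inequality a n₁ d₁ n d q₁≤a a≤q) ⟩
  a * ((n₁ + d₁) * (n + d)) * (A * M)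
    ≡⟨ rhs-regroup a A (n₁ + d₁) (n + d) M ⟩
  a * A * ((n₁ + d₁) * ((n + d) * M))
    ≡⟨ cong (λ z → a * A * ((n₁ + d₁) * z)) (sym (product-pick num⁺ pre (n , d) post)) ⟩
  a * A * ((n₁ + d₁) * product (map num⁺ (pre ++ (n , d) ∷ post))) ∎
  where
  open ≤-Reasoning
  merged : Frac
  merged = (n₁ * n , d₁ * d * a)
  N = product (map num (pre ++ post))
  M = product (map num⁺ (pre ++ post))
  lhs-regroup : ∀ x S n₁ n N → x * S * (n₁ * (n * N)) ≡ x * (S * (n₁ * n * N))
  lhs-regroup = solve-∀
  mid-regroup : ∀ x A y M → x * (A * (y * M)) ≡ x * y * (A * M)
  mid-regroup = solve-∀
  rhs-regroup : ∀ a A x y M → a * (x * y) * (A * M) ≡ a * A * (x * (y * M))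
  rhs-regroup = solve-∀

-- Induction on the cs: the head fraction is compared with c₁ = a directly if all later
-- fractions are below a, and otherwise merged into the first later fraction q ≥ a.
majorization : ∀ P cs qs → 1 ≤ P → AllPairs _≤_ cs → Dominated P P cs qs →
  product (map suc cs) * product (map num qs) ≤ product cs * product (map num⁺ qs)
majorization P [] [] _ _ _ = ≤-refl
majorization P (a ∷ cs) ((n₁ , d₁) ∷ qs) P≥1 (a≤cs ∷ sorted) (hd , tl)
  with firstAtLeast a qs | *-cancelˡ-≤ P {{>-nonZero P≥1}} hd
... | none below | q₁≤a = termwise-bound {a ∷ cs} {(n₁ , d₁) ∷ qs} (q₁≤a ∷ dominated-covers cs qs tl a≤cs below)
... | some pre n d post below a≤q | q₁≤a =
  merge-step a n₁ d₁ n d pre post (product (map suc cs)) (product cs) q₁≤a a≤q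
    (majorization P cs (pre ++ (n₁ * n , d₁ * d * a) ∷ post) P≥1 sorted
      (dominated-merge pre cs ≤-refl a≤cs below tl))

Chain : ℕ → List ℕ → Set
Chain w []       = ⊤
Chain w (l ∷ ls) = w * product (l ∷ ls) ≤ (w ∸ 1) * product (map suc (l ∷ ls)) × Chain (w * l) ls

F-square : ∀ r T → F (suc r) (T * T) ≡ F (suc (suc r)) T
F-square r T = cong₂ _∸_ (square-power (2 ^ suc r)) (square-power (2 ^ r))
  where
  square-power : ∀ e → (T * T) ^ e ≡ T ^ (2 * e)
  square-power e = trans (cong (λ y → (T * y) ^ e) (sym (*-identityʳ T))) (^-*-assoc T 2 e)

square-step : ∀ v T l l′ ls →
  v * l * product (l′ ∷ ls) ≤ F (suc (length ls)) (T * T) →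
  v * product (l ∷ l′ ∷ ls) ≤ F (suc (suc (length ls))) T
square-step v T l l′ ls = subst₂ _≤_ (*-assoc v l (product (l′ ∷ ls))) (F-square (length ls) T)

-- If 1 ≤ v ≤ T then T/(T − 1) ≤ v/(v − 1), so a ratio bound for v transfers to T.
ratio-transfer : ∀ {v T x y} → 1 ≤ v → v ≤ T → v * x ≤ (v ∸ 1) * y → T * x ≤ (T ∸ 1) * y
ratio-transfer {v} {T} {x} {y} v≥1 v≤T vx≤ = *-cancelˡ-≤ v {{>-nonZero v≥1}} (begin
  v * (T * x)       ≡⟨ x∙yz≈y∙xz v T x ⟩
  T * (v * x)       ≤⟨ *-monoʳ-≤ T vx≤ ⟩
  T * ((v ∸ 1) * y) ≡⟨ sym (*-assoc T (v ∸ 1) y) ⟩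
  T * (v ∸ 1) * y   ≤⟨ *-monoˡ-≤ y cross ⟩
  v * (T ∸ 1) * y   ≡⟨ *-assoc v (T ∸ 1) y ⟩
  v * ((T ∸ 1) * y) ∎)
  where
  open ≤-Reasoning
  -- T (v − 1) = T v − T ≤ v T − v = v (T − 1)
  cross : T * (v ∸ 1) ≤ v * (T ∸ 1)
  cross = subst₂ _≤_ (sym (*-distribˡ-∸ T v 1)) (sym (*-distribˡ-∸ v T 1))
            (∸-mono (≤-reflexive (*-comm T v)) (*-monoˡ-≤ 1 v≤T))

Overshoots : ℕ → ℕ → List ℕ → Set
Overshoots v T []            = ⊤
Overshoots v T (l ∷ [])      = ⊤
Overshoots v T (l ∷ l′ ∷ ls) = T * T < v * l × Overshoots (v * l) (T * T) (l′ ∷ ls)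

overshoots? : ∀ v T ls → Dec (Overshoots v T ls)
overshoots? v T []            = yes tt
overshoots? v T (l ∷ [])      = yes tt
overshoots? v T (l ∷ l′ ∷ ls) = (T * T <? v * l) ×-dec overshoots? (v * l) (T * T) (l′ ∷ ls)

-- The extremal comparison fractions  T/1, T²/1, …, T^(2^(R−2))/1, x_R / T^(2^(R−1)),
-- where x_R = v λ₁ ⋯ λ_R.
comparison : ℕ → ℕ → List ℕ → List Frac
comparison v T []            = []
comparison v T (l ∷ [])      = (v * l , T) ∷ []
comparison v T (l ∷ l′ ∷ ls) = (T , 1) ∷ comparison (v * l) (T * T) (l′ ∷ ls)

overshoots-dominated : ∀ v T ls → Overshoots v T ls → Dominated T v ls (comparison v T ls)
overshoots-dominated v T []            _ = tt
overshoots-dominated v T (l ∷ [])      _ = ≤-reflexive (rearrange T v l) , tt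
  where
  rearrange : ∀ T v l → T * (v * l) ≡ v * (l * T)
  rearrange = solve-∀
overshoots-dominated v T (l ∷ l′ ∷ ls) (T²<vl , rest) =
  subst (T * T ≤_) vl≡ (<⇒≤ T²<vl) ,
  subst (λ y → Dominated (T * T) y (l′ ∷ ls) (comparison (v * l) (T * T) (l′ ∷ ls))) vl≡
    (overshoots-dominated (v * l) (T * T) (l′ ∷ ls) rest)
  where
  vl≡ : v * l ≡ v * (l * 1)
  vl≡ = cong (v *_) (sym (*-identityʳ l))

last-factor-bound : ∀ t X → suc t * X ≤ t * (X + suc t) → X ≤ F 1 (suc t)
last-factor-bound t X ineq = subst (X ≤_) (sym F₁) (+-cancelˡ-≤ (t * X) _ _ expanded)
  where
  expand : ∀ t X → t * (X + suc t) ≡ t * X + t * suc t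
  expand = solve-∀
  expanded : t * X + X ≤ t * X + t * suc t
  expanded = subst₂ _≤_ (+-comm X (t * X)) (expand t X) ineq
  square : ∀ t → suc t * (suc t * 1) ≡ suc t * 1 + t * suc t
  square = solve-∀
  F₁ : F 1 (suc t) ≡ t * suc t
  F₁ = trans (cong (_∸ (suc t * 1)) (square t)) (m+n∸m≡n (suc t * 1) (t * suc t))

-- Removing the first factor 1 + 1/T leaves T²/(T² − 1) ≤ ∏ over the comparison fractions of the
-- tail with data (v λ₁, T²), since (T − 1)(T + 1) = T² − 1; the last fraction gives the base case.
comparison-bound : ∀ v T l ls → 1 ≤ T →
  T * product (map num (comparison v T (l ∷ ls))) ≤ (T ∸ 1) * product (map num⁺ (comparison v T (l ∷ ls))) →
  v * product (l ∷ ls) ≤ F (length (l ∷ ls)) T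
comparison-bound v (suc t) l []        _ ineq =
  subst (_≤ F 1 (suc t)) (*-assoc v l 1)
    (last-factor-bound t (v * l * 1) (subst (suc t * (v * l * 1) ≤_) (cong (t *_) (times-one v l t)) ineq))
  where
  times-one : ∀ v l t → (v * l + suc t) * 1 ≡ v * l * 1 + suc t
  times-one = solve-∀
comparison-bound v (suc t) l (l′ ∷ ls) _ ineq =
  square-step v (suc t) l l′ ls
    (comparison-bound (v * l) (suc t * suc t) l′ ls (s≤s z≤n)
      (subst₂ _≤_ (sym (*-assoc (suc t) (suc t) N)) (difference-of-squares t S) ineq))
  where
  N = product (map num (comparison (v * l) (suc t * suc t) (l′ ∷ ls)))
  S = product (map num⁺ (comparison (v * l) (suc t * suc t) (l′ ∷ ls)))
  difference-of-squares : ∀ t S → t * ((suc t + 1) * S) ≡ (t + t * suc t) * S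
  difference-of-squares = solve-∀

-- The overshooting case: the first chain condition plus majorization against the comparison
-- fractions gives  T/(T − 1) ≤ v/(v − 1) ≤ ∏ (1 + 1/λ) ≤ ∏ (1 + 1/q), then comparison-bound.
overshoot-bound : ∀ v T l ls → v ≤ T → Overshoots v T (l ∷ ls) → AllPairs _≤_ (l ∷ ls) → All (1 ≤_) (l ∷ ls) →
  v * product (l ∷ ls) ≤ (v ∸ 1) * product (map suc (l ∷ ls)) →
  v * product (l ∷ ls) ≤ F (length (l ∷ ls)) T
overshoot-bound zero     T l ls _   _    _      _   _     = z≤n
overshoot-bound v@(suc _) T l ls v≤T over sorted pos first =
  comparison-bound v T l ls (≤-trans (s≤s z≤n) v≤T) (ratio-transfer (s≤s z≤n) v≤T ratio-v)
  where
  qs = comparison v T (l ∷ ls)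
  A = product (l ∷ ls)
  S = product (map suc (l ∷ ls))
  Nq = product (map num qs)
  Sq = product (map num⁺ qs)
  majorized : S * Nq ≤ A * Sq
  majorized = majorization v (l ∷ ls) qs (s≤s z≤n) sorted
                (dominated-antitone (l ∷ ls) qs v≤T (overshoots-dominated v T (l ∷ ls) over))
  ratio-v : v * Nq ≤ (v ∸ 1) * Sq
  ratio-v = *-cancelˡ-≤ A {{product≢0 (All.map >-nonZero pos)}} (begin
    A * (v * Nq)       ≡⟨ x∙yz≈yx∙z A v Nq ⟩
    v * A * Nq         ≤⟨ *-monoˡ-≤ Nq first ⟩
    (v ∸ 1) * S * Nq   ≡⟨ *-assoc (v ∸ 1) S Nq ⟩
    (v ∸ 1) * (S * Nq) ≤⟨ *-monoʳ-≤ (v ∸ 1) majorized ⟩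
    (v ∸ 1) * (A * Sq) ≡⟨ x∙yz≈y∙xz (v ∸ 1) A Sq ⟩
    A * ((v ∸ 1) * Sq) ∎)
    where open ≤-Reasoning

-- If all proper prefixes overshoot the squares of T we are in the extremal case; otherwise we
-- pass (square-step) to the tail after the first prefix that does not overshoot.
mutual
  chain-bound : ∀ v T l ls → v ≤ T → AllPairs _≤_ (l ∷ ls) → All (1 ≤_) (l ∷ ls) → Chain v (l ∷ ls) →
    v * product (l ∷ ls) ≤ F (length (l ∷ ls)) T
  chain-bound v T l ls v≤T sorted pos chain with overshoots? v T (l ∷ ls)
  ... | yes over = overshoot-bound v T l ls v≤T over sorted pos (proj₁ chain)
  ... | no ¬over = skip-overshoots v T l ls ¬over sorted pos chain

  skip-overshoots : ∀ v T l ls → ¬ Overshoots v T (l ∷ ls) → AllPairs _≤_ (l ∷ ls) → All (1 ≤_) (l ∷ ls) →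
    Chain v (l ∷ ls) → v * product (l ∷ ls) ≤ F (length (l ∷ ls)) T
  skip-overshoots v T l []        ¬over _ _ _ = ⊥-elim (¬over tt)
  skip-overshoots v T l (l′ ∷ ls) ¬over (_ ∷ sorted) (_ ∷ pos) (_ , chain) with v * l ≤? T * T
  ... | yes vl≤T² = square-step v T l l′ ls (chain-bound (v * l) (T * T) l′ ls vl≤T² sorted pos chain)
  ... | no  vl≰T² = square-step v T l l′ ls
          (skip-overshoots (v * l) (T * T) l′ ls (λ over → ¬over (≰⇒> vl≰T² , over)) sorted pos chain)

-- Sums and products over Fin n in a commutative semiring, as folds over tabulate, so that
-- the product over Fin n is definitionally the product of the tabulated list.
module BigOperators {c ℓ} (S : CommutativeSemiring c ℓ) where
  private
    module S = CommutativeSemiring S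
  open S using (Carrier; _≈_)
  open CommSemigroupProperties S.*-commutativeSemigroup using () renaming (interchange to ∙-interchange)

  ∑ : ∀ {n} → (Fin n → Carrier) → Carrier
  ∑ f = foldr S._+_ S.0# (tabulate f)

  ∏ : ∀ {n} → (Fin n → Carrier) → Carrier
  ∏ f = foldr S._*_ S.1# (tabulate f)

  ∑-cong : ∀ {n} {f g : Fin n → Carrier} → (∀ i → f i ≡ g i) → ∑ f ≡ ∑ g
  ∑-cong f≡g = cong (foldr S._+_ S.0#) (tabulate-cong f≡g)

  ∏-cong : ∀ {n} {f g : Fin n → Carrier} → (∀ i → f i ≡ g i) → ∏ f ≡ ∏ g
  ∏-cong f≡g = cong (foldr S._*_ S.1#) (tabulate-cong f≡g)

  ∏-distrib : ∀ {n} (f g : Fin n → Carrier) → ∏ (λ i → f i S.* g i) ≈ ∏ f S.* ∏ g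
  ∏-distrib {zero}  f g = S.sym (S.*-identityˡ S.1#)
  ∏-distrib {suc n} f g = S.trans (S.*-congˡ (∏-distrib (f ∘ fsuc) (g ∘ fsuc)))
                                  (∙-interchange (f fzero) (g fzero) (∏ (f ∘ fsuc)) (∏ (g ∘ fsuc)))

  ∑-distribʳ : ∀ {n} (f : Fin n → Carrier) x → ∑ f S.* x ≈ ∑ (λ i → f i S.* x)
  ∑-distribʳ {zero}  f x = S.zeroˡ x
  ∑-distribʳ {suc n} f x = S.trans (S.distribʳ x (f fzero) (∑ (f ∘ fsuc))) (S.+-congˡ (∑-distribʳ (f ∘ fsuc) x))

module ℕ-Big = BigOperators +-*-commutativeSemiring
module ℚ-Big = BigOperators (CommutativeRing.commutativeSemiring QP.+-*-commutativeRing)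

open ℕ-Big using () renaming (∑ to ∑ℕ; ∏ to ∏ℕ)
open ℚ-Big using () renaming (∑ to ∑ℚ; ∏ to ∏ℚ)

∏ℕ-mono : ∀ {n} {f g : Fin n → ℕ} → (∀ i → f i ≤ g i) → ∏ℕ f ≤ ∏ℕ g
∏ℕ-mono {zero}  f≤g = ≤-refl
∏ℕ-mono {suc n} f≤g = *-mono-≤ (f≤g fzero) (∏ℕ-mono (f≤g ∘ fsuc))

∑ℕ-mono : ∀ {n} {f g : Fin n → ℕ} → (∀ i → f i ≤ g i) → ∑ℕ f ≤ ∑ℕ g
∑ℕ-mono {zero}  f≤g = ≤-refl
∑ℕ-mono {suc n} f≤g = +-mono-≤ (f≤g fzero) (∑ℕ-mono (f≤g ∘ fsuc))

∏ℕ-positive : ∀ {n} {f : Fin n → ℕ} → (∀ i → 1 ≤ f i) → 1 ≤ ∏ℕ f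
∏ℕ-positive {zero}  f≥1 = ≤-refl
∏ℕ-positive {suc n} f≥1 = *-mono-≤ (f≥1 fzero) (∏ℕ-positive (f≥1 ∘ fsuc))

ι : ℕ → ℚ
ι n = (+ n) / 1

ιᵘ : ℕ → ℚᵘ
ιᵘ n = mkℚᵘ (+ n) 0

toℚᵘ-ι : ∀ n → toℚᵘ (ι n) U.≃ ιᵘ n
toℚᵘ-ι n = QP.toℚᵘ-fromℚᵘ (ιᵘ n)

ι-+ : ∀ m n → ι (m + n) ≡ ι m Q.+ ι n
ι-+ m n = QP.toℚᵘ-injective (UP.≃-trans (toℚᵘ-ι (m + n)) (UP.≃-trans (*≡* (cong (ℤ._* + 1) integral))
  (UP.≃-sym (UP.≃-trans (QP.toℚᵘ-homo-+ (ι m) (ι n)) (UP.+-cong (toℚᵘ-ι m) (toℚᵘ-ι n))))))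
  where
  integral : + (m + n) ≡ + m ℤ.* + 1 ℤ.+ + n ℤ.* + 1
  integral = trans (ℤP.pos-+ m n) (sym (cong₂ ℤ._+_ (ℤP.*-identityʳ (+ m)) (ℤP.*-identityʳ (+ n))))

ι-* : ∀ m n → ι (m * n) ≡ ι m Q.* ι n
ι-* m n = QP.toℚᵘ-injective (UP.≃-trans (toℚᵘ-ι (m * n)) (UP.≃-trans (*≡* (cong (ℤ._* + 1) (ℤP.pos-* m n)))
  (UP.≃-sym (UP.≃-trans (QP.toℚᵘ-homo-* (ι m) (ι n)) (UP.*-cong (toℚᵘ-ι m) (toℚᵘ-ι n))))))

ι-cancel-≤ : ∀ m n → ι m Q.≤ ι n → m ≤ n
ι-cancel-≤ m n ιm≤ιn with UP.≤-respʳ-≃ (toℚᵘ-ι n) (UP.≤-respˡ-≃ (toℚᵘ-ι m) (QP.toℚᵘ-mono-≤ ιm≤ιn))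
... | *≤* le = ℤP.drop‿+≤+ (subst₂ ℤ._≤_ (ℤP.*-identityʳ (+ m)) (ℤP.*-identityʳ (+ n)) le)

ι-cancel-< : ∀ m n → ι m Q.< ι n → m < n
ι-cancel-< m n ιm<ιn with UP.<-respʳ-≃ (toℚᵘ-ι n) (UP.<-respˡ-≃ (toℚᵘ-ι m) (QP.toℚᵘ-mono-< ιm<ιn))
... | *<* lt = ℤP.drop‿+<+ (subst₂ ℤ._<_ (ℤP.*-identityʳ (+ m)) (ℤP.*-identityʳ (+ n)) lt)

ι-positive : ∀ n → 1 ≤ n → Q.Positive (ι n)
ι-positive (suc n) _ = QP.normalize-pos (suc n) 1

cancel-denominator : ∀ p q → ((+ p) / suc q) Q.* ι (suc q) ≡ ι p
cancel-denominator p q = QP.toℚᵘ-injective (UP.≃-trans (QP.toℚᵘ-homo-* ((+ p) / suc q) (ι (suc q)))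
  (UP.≃-trans (UP.*-cong (QP.toℚᵘ-fromℚᵘ (mkℚᵘ (+ p) q)) (toℚᵘ-ι (suc q)))
  (UP.≃-trans (*≡* cross) (UP.≃-sym (toℚᵘ-ι p)))))
  where
  cross : (+ p ℤ.* + suc q) ℤ.* + 1 ≡ + p ℤ.* + (suc q * 1)
  cross = trans (ℤP.*-identityʳ _) (cong (λ z → + p ℤ.* + z) (sym (*-identityʳ (suc q))))

scaled-≤ : ∀ n x {s} → s Q.* ι n ≡ ι x → 1ℚ Q.≤ s → n ≤ x
scaled-≤ n x {s} s·n≡x 1≤s = ι-cancel-≤ n x
  (subst₂ Q._≤_ (QP.*-identityˡ (ι n)) s·n≡x (QP.*-monoʳ-≤-nonNeg (ι n) {{QP.normalize-nonNeg n 1}} 1≤s))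

scaled-< : ∀ n x {s} → 1 ≤ n → s Q.* ι n ≡ ι x → s Q.< 1ℚ → x < n
scaled-< n x {s} n≥1 s·n≡x s<1 = ι-cancel-< x n
  (subst₂ Q._<_ s·n≡x (QP.*-identityˡ (ι n)) (QP.*-monoˡ-<-pos (ι n) {{ι-positive n n≥1}} s<1))

∑-ι : ∀ {n} (g : Fin n → ℕ) → ∑ℚ (ι ∘ g) ≡ ι (∑ℕ g)
∑-ι {zero}  g = refl
∑-ι {suc n} g = trans (cong (ι (g fzero) Q.+_) (∑-ι (g ∘ fsuc))) (sym (ι-+ (g fzero) (∑ℕ (g ∘ fsuc))))

∏-ι : ∀ {n} (g : Fin n → ℕ) → ∏ℚ (ι ∘ g) ≡ ι (∏ℕ g)
∏-ι {zero}  g = refl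
∏-ι {suc n} g = trans (cong (ι (g fzero) Q.*_) (∏-ι (g ∘ fsuc))) (sym (ι-* (g fzero) (∏ℕ (g ∘ fsuc))))

cofactor : ∀ {n} → (Fin n → ℕ) → Fin n → ℕ
cofactor {suc n} a fzero    = ∏ℕ (a ∘ fsuc)
cofactor {suc n} a (fsuc i) = a fzero * cofactor (a ∘ fsuc) i

cofactor-spec : ∀ {n} (a : Fin n → ℕ) i → a i * cofactor a i ≡ ∏ℕ a
cofactor-spec {suc n} a fzero    = refl
cofactor-spec {suc n} a (fsuc i) = begin
  a (fsuc i) * (a fzero * cofactor (a ∘ fsuc) i) ≡⟨ x∙yz≈y∙xz (a (fsuc i)) (a fzero) _ ⟩
  a fzero * (a (fsuc i) * cofactor (a ∘ fsuc) i) ≡⟨ cong (a fzero *_) (cofactor-spec (a ∘ fsuc) i) ⟩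
  a fzero * ∏ℕ (a ∘ fsuc)                        ∎
  where
  open ≡-Reasoning

factor-cleared : ∀ (c : Bool) M → 1 < M →
  (if c then invFactor M else 1ℚ) Q.* ι (M ∸ 1) ≡ ι (if c then M else M ∸ 1)
factor-cleared true  (suc (suc n)) _         = cancel-denominator (suc (suc n)) n
factor-cleared true  (suc zero)    (s≤s ())
factor-cleared false M             _         = QP.*-identityˡ (ι (M ∸ 1))

term-cleared : ∀ x → 1 ≤ x → ∀ b c P D H → P Q.* ι D ≡ ι H →
  frac b x Q.* P Q.* ι (x * c * D) ≡ ι (b * c * H)
term-cleared (suc x) _ b c P D H P-cleared = begin
  frac b (suc x) Q.* P Q.* ι (suc x * c * D)
    ≡⟨ cong (frac b (suc x) Q.* P Q.*_) (trans (ι-* (suc x * c) D) (cong (Q._* ι D) (ι-* (suc x) c))) ⟩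
  frac b (suc x) Q.* P Q.* (ι (suc x) Q.* ι c Q.* ι D)
    ≡⟨ regroup (frac b (suc x)) P (ι (suc x)) (ι c) (ι D) ⟩
  frac b (suc x) Q.* ι (suc x) Q.* ι c Q.* (P Q.* ι D)
    ≡⟨ cong₂ (λ u v → u Q.* ι c Q.* v) (cancel-denominator b x) P-cleared ⟩
  ι b Q.* ι c Q.* ι H
    ≡⟨ sym (trans (ι-* (b * c) H) (cong (Q._* ι H) (ι-* b c))) ⟩
  ι (b * c * H) ∎
  where
  open ≡-Reasoning
  open +-*-Solver
  regroup : ∀ f p x c d → f Q.* p Q.* (x Q.* c Q.* d) ≡ f Q.* x Q.* c Q.* (p Q.* d)
  regroup = solve 5 (λ f p x c d → f :* p :* (x :* c :* d) := f :* x :* c :* (p :* d)) refl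

before after : ∀ {n} → ℕ → (Fin n → ℕ) → ℕ
before r g = ∏ℕ (λ j → if toℕ j <ᵇ r then g j else 1)
after  r g = ∏ℕ (λ j → if toℕ j <ᵇ r then 1 else g j)

∏-split : ∀ {n} r (f g : Fin n → ℕ) → (∀ j → (toℕ j <ᵇ r) ≡ false → f j ≡ g j) →
  ∏ℕ f ≡ before r f * after r g
∏-split r f g agree = trans (ℕ-Big.∏-cong pointwise)
  (ℕ-Big.∏-distrib (λ j → if toℕ j <ᵇ r then f j else 1) (λ j → if toℕ j <ᵇ r then 1 else g j))
  where
  pointwise : ∀ j → f j ≡ (if toℕ j <ᵇ r then f j else 1) * (if toℕ j <ᵇ r then 1 else g j)
  pointwise j with toℕ j <ᵇ r in j≥r
  ... | true  = sym (*-identityʳ (f j))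
  ... | false = trans (agree j j≥r) (sym (+-identityʳ (g j)))

∏ℕ-ones : ∀ n → ∏ℕ {n} (λ _ → 1) ≡ 1
∏ℕ-ones zero    = refl
∏ℕ-ones (suc n) = trans (+-identityʳ _) (∏ℕ-ones n)

TailCondition : ∀ {n} → ℕ → (Fin n → ℕ) → ℕ → Set
TailCondition x g r = x * before r g * after r g ≤ (x * before r g ∸ 1) * after r (suc ∘ g)

-- The tail conditions at all positions r < n form a chain; position r + 1 of g is position r
-- of its tail g ∘ fsuc, with weight x · g 0.
chain-from-tails : ∀ {n} x (g : Fin n → ℕ) → (∀ r → r < n → TailCondition x g r) → Chain x (tabulate g)
chain-from-tails {zero}  x g tails = tt
chain-from-tails {suc n} x g tails = head , chain-from-tails (x * g fzero) (g ∘ fsuc) shifted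
  where
  ratio-cong : ∀ {y y′ e e′ f f′} → y ≡ y′ → e ≡ e′ → f ≡ f′ → y * e ≤ (y ∸ 1) * f → y′ * e′ ≤ (y′ ∸ 1) * f′
  ratio-cong refl refl refl ineq = ineq
  x-before : x * before 0 g ≡ x
  x-before = trans (cong (x *_) (trans (+-identityʳ _) (∏ℕ-ones n))) (*-identityʳ x)
  head : x * product (tabulate g) ≤ (x ∸ 1) * product (map suc (tabulate g))
  head = ratio-cong x-before refl (cong product (sym (map-tabulate g suc))) (tails 0 (s≤s z≤n))
  shifted : ∀ r → r < n → TailCondition (x * g fzero) (g ∘ fsuc) r
  shifted r (s≤s r<n) = ratio-cong (sym (*-assoc x (g fzero) (before r (g ∘ fsuc))))
    (*-identityˡ (after r (g ∘ fsuc))) (*-identityˡ (after r (suc ∘ g ∘ fsuc))) (tails (suc r) (s≤s (s≤s r<n)))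

<⇒≤∸1 : ∀ {m n} → m < n → m ≤ n ∸ 1
<⇒≤∸1 {n = suc n} (s≤s m≤n) = m≤n

select-mono : ∀ c {t t′} {M L : ℕ} → (T t → T t′) → L ≤ M →
  (if c ∧ t then M else L) ≤ (if c ∧ t′ then M else L)
select-mono false                  _    _   = ≤-refl
select-mono true  {true}  {true}   _    _   = ≤-refl
select-mono true  {true}  {false}  t⇒t′ _   = ⊥-elim (t⇒t′ tt)
select-mono true  {false} {true}   _    L≤M = L≤M
select-mono true  {false} {false}  _    _   = ≤-refl

-- At a position j ≥ r (t = false), trading the selected factor of level R for the factor M
-- of the tail product:  s L ≤ L M  with s ∈ {L, M}.  Positions j < r are unchanged.
exchange-factor : ∀ c t {tR} {M L : ℕ} → T tR → L ≤ M →
  (if c ∧ tR then M else L) * (if t then 1 else L) ≤ (if c ∧ t then M else L) * (if t then 1 else M)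
exchange-factor c     true  {true}         _ _   = ≤-refl
exchange-factor true  false {true} {M} {L} _ _   = ≤-reflexive (*-comm M L)
exchange-factor false false {true} {M} {L} _ L≤M = *-monoʳ-≤ L L≤M

-- With m-1 j = m_j − 1, A = ∏ a_i and D = ∏ (m_j − 1),
-- the sum of the statement at level L, multiplied by A · D, is the natural number
--   N L = ∑_i b_i (A / a_i) ∏_j cleared i L j,
-- where cleared i L j is m_j if j ∈ J_i and j < L, and m_j − 1 otherwise.
module Cleared {k R : ℕ} (m : Fin R → ℕ) (m>1 : ∀ j → 1 < m j) (J : Fin k → Subset R) (a b : Fin k → ℕ) where

  m-1 : Fin R → ℕ
  m-1 j = m j ∸ 1

  m≡suc : ∀ j → m j ≡ suc (m-1 j)
  m≡suc j = sym (m+[n∸m]≡n (<⇒≤ (m>1 j)))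

  m-1-positive : ∀ j → 1 ≤ m-1 j
  m-1-positive j = ∸-monoˡ-≤ 1 (m>1 j)

  m-1≤m : ∀ j → m-1 j ≤ m j
  m-1≤m j = m∸n≤m (m j) 1

  selected : Fin k → ℕ → Fin R → Bool
  selected i L j = ⌊ j ∈? J i ⌋ ∧ (toℕ j <ᵇ L)

  cleared : Fin k → ℕ → Fin R → ℕ
  cleared i L j = if selected i L j then m j else m-1 j

  A D : ℕ
  A = ∏ℕ a
  D = ∏ℕ m-1

  N : ℕ → ℕ
  N L = ∑ℕ (λ i → b i * cofactor a i * ∏ℕ (cleared i L))

  prodJ-cleared : ∀ i L → prodJ (J i) m L Q.* ι D ≡ ι (∏ℕ (cleared i L))
  prodJ-cleared i L = begin
    prodJ (J i) m L Q.* ι D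
      ≡⟨ cong₂ Q._*_ (cong (foldr Q._*_ 1ℚ) (map-tabulate id factor)) (sym (∏-ι m-1)) ⟩
    ∏ℚ factor Q.* ∏ℚ (ι ∘ m-1)
      ≡⟨ sym (ℚ-Big.∏-distrib factor (ι ∘ m-1)) ⟩
    ∏ℚ (λ j → factor j Q.* ι (m-1 j))
      ≡⟨ ℚ-Big.∏-cong (λ j → factor-cleared (selected i L j) (m j) (m>1 j)) ⟩
    ∏ℚ (ι ∘ cleared i L)
      ≡⟨ ∏-ι (cleared i L) ⟩
    ι (∏ℕ (cleared i L)) ∎
    where
    open ≡-Reasoning
    factor : Fin R → ℚ
    factor j = if selected i L j then invFactor (m j) else 1ℚ

  sumJ-cleared : (∀ i → 1 ≤ a i) → ∀ L → sumJ a b J m L Q.* ι (A * D) ≡ ι (N L)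
  sumJ-cleared a≥1 L = begin
    sumJ a b J m L Q.* ι (A * D)
      ≡⟨ cong (Q._* ι (A * D)) (cong (foldr Q._+_ Q.0ℚ) (map-tabulate id summand)) ⟩
    ∑ℚ summand Q.* ι (A * D)
      ≡⟨ ℚ-Big.∑-distribʳ summand (ι (A * D)) ⟩
    ∑ℚ (λ i → summand i Q.* ι (A * D))
      ≡⟨ ℚ-Big.∑-cong summand-cleared ⟩
    ∑ℚ (λ i → ι (b i * cofactor a i * ∏ℕ (cleared i L)))
      ≡⟨ ∑-ι (λ i → b i * cofactor a i * ∏ℕ (cleared i L)) ⟩
    ι (N L) ∎
    where
    open ≡-Reasoning
    summand : Fin k → ℚ
    summand i = frac (b i) (a i) Q.* prodJ (J i) m L
    summand-cleared : ∀ i → summand i Q.* ι (A * D) ≡ ι (b i * cofactor a i * ∏ℕ (cleared i L))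
    summand-cleared i =
      subst (λ x → summand i Q.* ι (x * D) ≡ ι (b i * cofactor a i * ∏ℕ (cleared i L))) (cofactor-spec a i)
        (term-cleared (a i) (a≥1 i) (b i) (cofactor a i) (prodJ (J i) m L) D (∏ℕ (cleared i L)) (prodJ-cleared i L))

  -- Raising the level selects more factors m_j ≥ m_j − 1.
  N-mono : ∀ {L L′} → L ≤ L′ → N L ≤ N L′
  N-mono {L} {L′} L≤L′ = ∑ℕ-mono (λ i → *-monoʳ-≤ (b i * cofactor a i)
    (∏ℕ-mono (λ j → select-mono ⌊ j ∈? J i ⌋ (widen j) (m-1≤m j))))
    where
    widen : ∀ j → T (toℕ j <ᵇ L) → T (toℕ j <ᵇ L′)
    widen j j<L = <⇒<ᵇ (<-≤-trans (<ᵇ⇒< (toℕ j) L j<L) L≤L′)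

  -- Splitting A · D and N r at position r: beyond r nothing is selected at level r.
  AD-split : ∀ r → A * D ≡ A * before r m-1 * after r m-1
  AD-split r = trans (cong (A *_) (∏-split r m-1 m-1 (λ _ _ → refl))) (sym (*-assoc A _ _))

  N-before : ℕ → ℕ
  N-before r = ∑ℕ (λ i → b i * cofactor a i * before r (cleared i r))

  N-split : ∀ r → N r ≡ N-before r * after r m-1
  N-split r = trans (ℕ-Big.∑-cong (λ i → trans (cong (b i * cofactor a i *_) (∏-split r (cleared i r) m-1 (unselected i)))
                                               (sym (*-assoc (b i * cofactor a i) _ _))))
                    (sym (ℕ-Big.∑-distribʳ (λ i → b i * cofactor a i * before r (cleared i r)) (after r m-1)))
    where
    unselected : ∀ i j → (toℕ j <ᵇ r) ≡ false → cleared i r j ≡ m-1 j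
    unselected i j j≥r = cong (λ c → if c then m j else m-1 j)
                              (trans (cong (⌊ j ∈? J i ⌋ ∧_) j≥r) (∧-zeroʳ ⌊ j ∈? J i ⌋))

  -- Passing from level R down to level r: each factor m_j selected at a position j ≥ r is traded
  -- for the corresponding factor of the tail product, so  N R ∏_{j≥r} (m_j − 1) ≤ N r ∏_{j≥r} m_j.
  N-exchange : ∀ r → N R * after r m-1 ≤ N r * after r (suc ∘ m-1)
  N-exchange r = subst₂ _≤_
    (sym (ℕ-Big.∑-distribʳ (λ i → b i * cofactor a i * ∏ℕ (cleared i R)) (after r m-1)))
    (trans (sym (ℕ-Big.∑-distribʳ (λ i → b i * cofactor a i * ∏ℕ (cleared i r)) (after r m)))
           (cong (N r *_) (ℕ-Big.∏-cong (λ j → cong (λ x → if toℕ j <ᵇ r then 1 else x) (m≡suc j)))))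
    (∑ℕ-mono (λ i → subst₂ _≤_ (sym (*-assoc (b i * cofactor a i) _ _)) (sym (*-assoc (b i * cofactor a i) _ _))
      (*-monoʳ-≤ (b i * cofactor a i) (termwise i))))
    where
    termwise : ∀ i → ∏ℕ (cleared i R) * after r m-1 ≤ ∏ℕ (cleared i r) * after r m
    termwise i = subst₂ _≤_ (ℕ-Big.∏-distrib (cleared i R) _) (ℕ-Big.∏-distrib (cleared i r) _)
      (∏ℕ-mono (λ j → exchange-factor ⌊ j ∈? J i ⌋ (toℕ j <ᵇ r) (<⇒<ᵇ (toℕ<n j)) (m-1≤m j)))

  tail-conditions : A * D ≤ N R → N (R ∸ 1) < A * D → ∀ r → r < R → TailCondition A m-1 r
  tail-conditions AD≤N N<AD r r<R = *-cancelʳ-≤ (X * E′) ((X ∸ 1) * E) E′ {{>-nonZero E′≥1}} (begin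
    X * E′ * E′      ≡⟨ cong (_* E′) (sym (AD-split r)) ⟩
    A * D * E′       ≤⟨ *-monoˡ-≤ E′ AD≤N ⟩
    N R * E′         ≤⟨ N-exchange r ⟩
    N r * E          ≡⟨ cong (_* E) (N-split r) ⟩
    N-before r * E′ * E  ≤⟨ *-monoˡ-≤ E (*-monoˡ-≤ E′ (<⇒≤∸1 before<X)) ⟩
    (X ∸ 1) * E′ * E ≡⟨ xy∙z≈xz∙y (X ∸ 1) E′ E ⟩
    (X ∸ 1) * E * E′ ∎)
    where
    open ≤-Reasoning
    X = A * before r m-1
    E′ = after r m-1
    E = after r (suc ∘ m-1)
    E′≥1 : 1 ≤ E′
    E′≥1 = ∏ℕ-positive (λ j → tail-positive (toℕ j <ᵇ r) (m-1-positive j))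
      where
      tail-positive : ∀ t {x} → 1 ≤ x → 1 ≤ (if t then 1 else x)
      tail-positive true  _   = ≤-refl
      tail-positive false x≥1 = x≥1
    before<X : N-before r < X
    before<X = *-cancelʳ-< E′ (N-before r) X
      (subst₂ _<_ (N-split r) (AD-split r) (≤-<-trans (N-mono (<⇒≤∸1 r<R)) N<AD))

lemma6 : (k R : ℕ) → 1 ≤ k → 1 ≤ R →
    (m : Fin R → ℕ) → (∀ j → 1 < m j) → (∀ i j → i ≤ᶠ j → m i ≤ m j) →
    (J : Fin k → Subset R) →
    (∀ i i' j → i ≢ i' → j ∈ J i → j ∈ J i' → ⊥) →
    (∀ j → ∃ λ i → j ∈ J i) →
    (a b : Fin k → ℕ) → (∀ i → 1 ≤ a i) → (∀ i → 1 ≤ b i) →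
    1ℚ ≤ℚ sumJ a b J m R →
    sumJ a b J m (R ∸ 1) <ℚ 1ℚ →
    prodℕ a * prodℕ (λ j → m j ∸ 1) ≤ F R (prodℕ a)
lemma6 _ (suc R′) _ _ m m>1 m-mono J _ _ a b a≥1 _ sum≥1 sum′<1 =
  subst₂ _≤_ (cong₂ _*_ (sym A≡) (sym D≡)) (cong₂ F (length-tabulate m-1) (sym A≡))
    (chain-bound A A (m-1 fzero) (tabulate (m-1 ∘ fsuc)) ≤-refl sorted positive chain)
  where
  open Cleared m m>1 J a b
  A≡ : prodℕ a ≡ A
  A≡ = cong product (map-tabulate id a)
  D≡ : prodℕ m-1 ≡ D
  D≡ = cong product (map-tabulate id m-1)
  AD≥1 : 1 ≤ A * D
  AD≥1 = *-mono-≤ (∏ℕ-positive a≥1) (∏ℕ-positive m-1-positive)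
  chain : Chain A (tabulate m-1)
  chain = chain-from-tails A m-1 (tail-conditions
    (scaled-≤ (A * D) (N (suc R′)) (sumJ-cleared a≥1 (suc R′)) sum≥1)
    (scaled-< (A * D) (N R′) AD≥1 (sumJ-cleared a≥1 R′) sum′<1))
  sorted : AllPairs _≤_ (tabulate m-1)
  sorted = tabulate⁺-< (λ {i} {j} i<j → ∸-monoˡ-≤ 1 (m-mono i j (<⇒≤ i<j)))
  positive : All (1 ≤_) (tabulate m-1)
  positive = AllP.tabulate⁺ m-1-positive
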